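{- Let $P_n$ be the path with vertices $1,\ldots,n$ and let $A$ be a set of vertices with $2\leq|A|\leq n$. Then the set returned by Ascending Local Search$(P_n,W,A)$ is a maximizer of $W$, i.e. it has cardinality $|A|$ and has the largest value of $W$ among all vertex sets of that cardinality.
   Context: $d(u,v)=|u-v|$ in $P_n$ and $W(X)=\sum_{\{u,v\}\subseteq X,\,u\neq v}d(u,v)$ (unordered pairs). A perturbation of $X$ is a set $(X\setminus\{u\})\cup\{v\}$ with $u\in X$, $v\notin X$, $\{u,v\}$ an edge. Ascending Local Search$(G,F,A)$: set $X=A$; let $L$ be the list of all perturbations of $X$; if $F(L(i))>F(X)$ for some $i$, replace $X$ by $L(j)$ for the least such $j$ and repeat; otherwise (if $F(L(i))\leq F(X)$ for all $i$) return $X$. -}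

module Defs where

open import Data.Nat using (ℕ; _+_; _∸_; _≤_; _<_; _<ᵇ_)
open import Data.Bool using (Bool; true; false; if_then_else_; _∧_)
open import Data.Fin using (Fin; toℕ)
open import Data.Fin.Subset using (Subset; _∈_; _∉_; _∪_; _-_; ⁅_⁆)
open import Data.List using (List; _∷_; _++_; map; allFin)
open import Data.Nat.ListAction using (sum)
open import Data.List.Relation.Unary.All using (All)
import Data.List.Membership.Propositional as LM
open import Data.Vec using (lookup)
open import Data.Product using (Σ; _×_)
open import Data.Sum using (_⊎_)
open import Relation.Binary.PropositionalEquality using (_≡_)

-- Vertex k : Fin n of P_n represents the vertex (toℕ k + 1); vertex sets are Subset n.

Edge : ∀ {n} → Fin n → Fin n → Set
Edge u v = (Data.Nat.suc (toℕ u) ≡ toℕ v) ⊎ (Data.Nat.suc (toℕ v) ≡ toℕ u)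

dist : ∀ {n} → Fin n → Fin n → ℕ
dist u v = (toℕ u ∸ toℕ v) + (toℕ v ∸ toℕ u)

-- W(X) = sum over unordered pairs {u,v} ⊆ X, u ≠ v, of d(u,v)
-- (each unordered pair counted once, as the ordered pair with toℕ u < toℕ v)
W : ∀ {n} → Subset n → ℕ
W {n} X = sum (map (λ u → sum (map (λ v →
            if (lookup X u ∧ lookup X v ∧ (toℕ u <ᵇ toℕ v)) then dist u v else 0)
          (allFin n))) (allFin n))

IsPerturbation : ∀ {n} → Subset n → Subset n → Set
IsPerturbation {n} X Y =
  Σ (Fin n) λ u → Σ (Fin n) λ v →
    (u ∈ X) × (v ∉ X) × Edge u v × (Y ≡ (X - u) ∪ ⁅ v ⁆)

-- A listing of perturbations: for each X, L X lists exactly the perturbations of X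
-- (in an arbitrary order, as the algorithm does not fix one).
ListsPerturbations : ∀ {n} → (Subset n → List (Subset n)) → Set
ListsPerturbations {n} L =
  ∀ (X Y : Subset n) → (Y LM.∈ L X → IsPerturbation X Y) × (IsPerturbation X Y → Y LM.∈ L X)

data ALS {n} (L : Subset n → List (Subset n)) (F : Subset n → ℕ)
     : Subset n → Subset n → Set where
  stop : ∀ {X} → All (λ Y → F Y ≤ F X) (L X) → ALS L F X X
  step : ∀ {X R} (pre post : List (Subset n)) (Y : Subset n) →
         L X ≡ pre ++ (Y ∷ post) →
         All (λ Z → F Z ≤ F X) pre →
         F X < F Y →
         ALS L F Y R → ALS L F X R

{-# OPTIONS --safe #-}
module Submission where

-- Read a vertex set X of P_n as the bit list toList X. Since d(u,v) is the number of edges of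
-- P_n between u and v, W(X) is the sum over the edges (cuts of the list) of c·d, where c and d
-- count the members of X to the left and to the right. Moving a member one step left across an
-- edge changes only that edge's term, from c(d+1) to (c+1)d, where c and d now count the other
-- members. So at a local maximum every 01 has at least as many ones before it as after it, and
-- every 10 at least as many after as before. Propagated along the list, this gives at every cut
-- either |c - d| ≤ 1 or a completely full lighter side; in both cases no set of the same size
-- has a larger product there, so W is maximal term by term. Ascending local search terminates
-- because W is bounded, and it keeps the cardinality because perturbations do.

open import Defs
open import Data.Nat using (ℕ; zero; suc; _+_; _*_; _≤_; _<_; _<ᵇ_; z≤n; s≤s)
open import Data.Nat.Properties
open import Data.Nat.Tactic.RingSolver using (solve-∀)
open import Data.Nat.ListAction using (sum)
open import Data.Bool using (Bool; true; false; if_then_else_; _∧_)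
open import Data.Bool.Properties using (∧-identityʳ; ∧-zeroʳ; ∨-identityʳ)
open import Data.Fin using (Fin; zero; suc; toℕ)
open import Data.Fin.Subset using (Subset; ∣_∣; _∈_; _∉_; _-_; _∪_; ⁅_⁆)
open import Data.Fin.Subset.Properties using (p─⊥≡p; ∪-identityʳ; p─q⊆p; drop-there)
open import Data.List using (List; []; _∷_; _++_; [_]; length; reverse; map; allFin)
open import Data.List.Properties
  using (++-assoc; length-++; length-reverse; reverse-++; reverse-involutive; ʳ++-defn;
         unfold-reverse; map-tabulate; map-cong; ∷-injective)
open import Data.List.Membership.Propositional using () renaming (_∈_ to _∈ₗ_)
open import Data.List.Membership.Propositional.Properties using (∈-∃++; ∈-++⁺ʳ)
open import Data.List.Relation.Unary.All as All using (All)
open import Data.List.Relation.Unary.Any as Any using ()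
import Data.List.Relation.Unary.First as First
open import Data.List.Relation.Unary.First.Properties using (toView)
open import Data.Vec using (_∷_; []; lookup; toList; here; there)
open import Data.Vec.Properties using (length-toList)
open import Data.Product using (Σ; Σ-syntax; _×_; _,_; proj₁; proj₂)
open import Data.Sum using (_⊎_; inj₁; inj₂) renaming (map to ⊎-map)
open import Function using (_∘_; id)
open import Relation.Nullary using (yes; no; contradiction)
open import Relation.Binary.PropositionalEquality
  using (_≡_; _≢_; refl; sym; trans; cong; cong₂; subst; subst₂; module ≡-Reasoning)

*-mono-balanced : ∀ {a b c d} → a ≤ c → c ≤ d → a + b ≡ c + d → a * b ≤ c * d
*-mono-balanced {a} {b} {c} {d} a≤c c≤d a+b≡c+d
  with e , refl ← m≤n⇒∃[o]m+o≡n a≤c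
  with refl ← +-cancelˡ-≡ a b (e + d) (trans a+b≡c+d (+-assoc a e d)) = begin
    a * (e + d)    ≡⟨ *-distribˡ-+ a e d ⟩
    a * e + a * d  ≤⟨ +-monoˡ-≤ (a * d) (*-monoˡ-≤ e (≤-trans a≤c c≤d)) ⟩
    d * e + a * d  ≡⟨ cong (_+ a * d) (*-comm d e) ⟩
    e * d + a * d  ≡⟨ +-comm (e * d) (a * d) ⟩
    a * d + e * d  ≡⟨ *-distribʳ-+ d a e ⟨
    (a + e) * d    ∎
  where open ≤-Reasoning

-- c ≤ d are the ones on the two sides of a cut whose left side has p places, and c', d' those
-- of another list with as many ones; the last hypothesis says a non-full left side is not
-- much lighter than the right one.
cut-product-≤ : ∀ {p c d c' d'} → c ≤ d → c' ≤ p → c' + d' ≡ c + d →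
                (c < p → d ≤ suc c) → c' * d' ≤ c * d
cut-product-≤ {p} {c} {d} {c'} {d'} c≤d c'≤p sums nonfull with c' ≤? c
... | yes c'≤c = *-mono-balanced c'≤c c≤d sums
... | no c'≰c  =
  subst (_≤ c * d) (*-comm d' c') (*-mono-balanced d'≤c c≤d (trans (+-comm d' c') sums))
  where
  open ≤-Reasoning
  c<c' : c < c'
  c<c' = ≰⇒> c'≰c
  d'≤c : d' ≤ c
  d'≤c = +-cancelˡ-≤ (suc c) d' c (begin
    suc c + d'  ≤⟨ +-monoˡ-≤ d' c<c' ⟩
    c' + d'     ≡⟨ sums ⟩
    c + d       ≤⟨ +-monoʳ-≤ c (nonfull (<-≤-trans c<c' c'≤p)) ⟩
    c + suc c   ≡⟨ +-comm c (suc c) ⟩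
    suc c + c   ∎)

[1+c]*d≤c*[1+d]⇒d≤c : ∀ c d → suc c * d ≤ c * suc d → d ≤ c
[1+c]*d≤c*[1+d]⇒d≤c c d le = +-cancelʳ-≤ (c * d) d c (subst (d + c * d ≤_) (*-suc c d) le)

+-assoc-cong₂ : ∀ {p q s s' x y} → p ≡ q → s + x ≡ s' + y → p + s + x ≡ q + s' + y
+-assoc-cong₂ {p} {q} {s} {s'} {x} {y} p≡q eq =
  trans (+-assoc p s x) (trans (cong₂ _+_ p≡q eq) (sym (+-assoc q s' y)))

count : List Bool → ℕ
count []          = 0
count (true ∷ l)  = suc (count l)
count (false ∷ l) = count l

count-++ : ∀ xs ys → count (xs ++ ys) ≡ count xs + count ys
count-++ []           ys = refl
count-++ (true ∷ xs)  ys = cong suc (count-++ xs ys)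
count-++ (false ∷ xs) ys = count-++ xs ys

count-++-true : ∀ xs → count (xs ++ [ true ]) ≡ suc (count xs)
count-++-true xs = trans (count-++ xs [ true ]) (+-comm (count xs) 1)

count-++-false : ∀ xs → count (xs ++ [ false ]) ≡ count xs
count-++-false xs = trans (count-++ xs [ false ]) (+-identityʳ (count xs))

count-reverse : ∀ xs → count (reverse xs) ≡ count xs
count-reverse []       = refl
count-reverse (x ∷ xs) = begin
  count (reverse (x ∷ xs))          ≡⟨ cong count (unfold-reverse x xs) ⟩
  count (reverse xs ++ [ x ])       ≡⟨ count-++ (reverse xs) [ x ] ⟩
  count (reverse xs) + count [ x ]  ≡⟨ cong (_+ count [ x ]) (count-reverse xs) ⟩
  count xs + count [ x ]            ≡⟨ +-comm (count xs) (count [ x ]) ⟩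
  count [ x ] + count xs            ≡⟨ count-++ [ x ] xs ⟨
  count (x ∷ xs)                    ∎
  where open ≡-Reasoning

count-swap : ∀ pre post → count (pre ++ false ∷ true ∷ post) ≡ count (pre ++ true ∷ false ∷ post)
count-swap pre post = trans (count-++ pre _) (sym (count-++ pre _))

count≤length : ∀ xs → count xs ≤ length xs
count≤length []           = z≤n
count≤length (true ∷ xs)  = s≤s (count≤length xs)
count≤length (false ∷ xs) = m≤n⇒m≤1+n (count≤length xs)

count<length⇒false∈ : ∀ {xs} → count xs < length xs → false ∈ₗ xs
count<length⇒false∈ {false ∷ xs} _        = Any.here refl
count<length⇒false∈ {true ∷ xs}  (s≤s lt) = Any.there (count<length⇒false∈ lt)

reverse-++-∷-∷ : ∀ {A : Set} (xs : List A) a b ys →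
                 reverse (xs ++ a ∷ b ∷ ys) ≡ reverse ys ++ b ∷ a ∷ reverse xs
reverse-++-∷-∷ xs a b ys = begin
  reverse (xs ++ a ∷ b ∷ ys)                ≡⟨ reverse-++ xs (a ∷ b ∷ ys) ⟩
  reverse (a ∷ b ∷ ys) ++ reverse xs        ≡⟨ cong (_++ reverse xs) (ʳ++-defn ys) ⟩
  (reverse ys ++ b ∷ a ∷ []) ++ reverse xs  ≡⟨ ++-assoc (reverse ys) (b ∷ a ∷ []) (reverse xs) ⟩
  reverse ys ++ b ∷ a ∷ reverse xs          ∎
  where open ≡-Reasoning

-- a is the number of ones to the left of the list.
cutSum : ℕ → List Bool → ℕ
cutSum a []          = 0
cutSum a (false ∷ l) = a * count l + cutSum a l
cutSum a (true ∷ l)  = suc a * count l + cutSum (suc a) l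

cutSum-∷ : ∀ P x T →
           cutSum (count P) (x ∷ T) ≡ count (P ++ [ x ]) * count T + cutSum (count (P ++ [ x ])) T
cutSum-∷ P true  T = cong (λ a → a * count T + cutSum a T) (sym (count-++-true P))
cutSum-∷ P false T = cong (λ a → a * count T + cutSum a T) (sym (count-++-false P))

cutSum-swap : ∀ a pre post →
  cutSum a (pre ++ false ∷ true ∷ post) + suc (a + count pre) * count post
    ≡ cutSum a (pre ++ true ∷ false ∷ post) + (a + count pre) * suc (count post)
cutSum-swap a []            post = swap-cut a (count post) (cutSum (suc a) post)
  where
  swap-cut : ∀ a d s → a * suc d + (suc a * d + s) + suc (a + 0) * d
                     ≡ suc a * d + (suc a * d + s) + (a + 0) * suc d
  swap-cut = solve-∀
cutSum-swap a (false ∷ pre) post =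
  +-assoc-cong₂ (cong (a *_) (count-swap pre post)) (cutSum-swap a pre post)
cutSum-swap a (true ∷ pre)  post rewrite +-suc a (count pre) =
  +-assoc-cong₂ (cong (suc a *_) (count-swap pre post)) (cutSum-swap (suc a) pre post)

SwapOptimal : List Bool → Set
SwapOptimal r = ∀ {pre x y post} → r ≡ pre ++ x ∷ y ∷ post → x ≢ y →
                cutSum 0 (pre ++ y ∷ x ∷ post) ≤ cutSum 0 r

ZeroOneBalanced : List Bool → Set
ZeroOneBalanced r = ∀ {pre post} → r ≡ pre ++ false ∷ true ∷ post → count post ≤ count pre

OneZeroBalanced : List Bool → Set
OneZeroBalanced r = ∀ {pre post} → r ≡ pre ++ true ∷ false ∷ post → count pre ≤ count post

swapOptimal⇒zeroOneBalanced : ∀ {r} → SwapOptimal r → ZeroOneBalanced r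
swapOptimal⇒zeroOneBalanced opt {pre} {post} refl =
  [1+c]*d≤c*[1+d]⇒d≤c c d (+-cancelˡ-≤ s₁₀ _ _ (begin
    s₁₀ + suc c * d  ≤⟨ +-monoˡ-≤ (suc c * d) (opt refl λ ()) ⟩
    s₀₁ + suc c * d  ≡⟨ cutSum-swap 0 pre post ⟩
    s₁₀ + c * suc d  ∎))
  where
  open ≤-Reasoning
  c d s₀₁ s₁₀ : ℕ
  c   = count pre
  d   = count post
  s₀₁ = cutSum 0 (pre ++ false ∷ true ∷ post)
  s₁₀ = cutSum 0 (pre ++ true ∷ false ∷ post)

swapOptimal⇒oneZeroBalanced : ∀ {r} → SwapOptimal r → OneZeroBalanced r
swapOptimal⇒oneZeroBalanced opt {pre} {post} refl =
  [1+c]*d≤c*[1+d]⇒d≤c d c (subst₂ _≤_ (*-comm c (suc d)) (*-comm (suc c) d)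
    (+-cancelˡ-≤ s₀₁ _ _ (begin
      s₀₁ + c * suc d  ≤⟨ +-monoˡ-≤ (c * suc d) (opt refl λ ()) ⟩
      s₁₀ + c * suc d  ≡⟨ cutSum-swap 0 pre post ⟨
      s₀₁ + suc c * d  ∎)))
  where
  open ≤-Reasoning
  c d s₀₁ s₁₀ : ℕ
  c   = count pre
  d   = count post
  s₀₁ = cutSum 0 (pre ++ false ∷ true ∷ post)
  s₁₀ = cutSum 0 (pre ++ true ∷ false ∷ post)

ones-after-zero : ∀ {r} → ZeroOneBalanced r → ∀ Q Y → r ≡ Q ++ false ∷ Y → count Y ≤ suc (count Q)
ones-after-zero bal Q []            eq = z≤n
ones-after-zero bal Q (true ∷ post) eq = s≤s (bal eq)
ones-after-zero bal Q (false ∷ Y)   eq =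
  subst (λ c → count Y ≤ suc c) (count-++-false Q)
    (ones-after-zero bal (Q ++ [ false ]) Y (trans eq (sym (++-assoc Q [ false ] (false ∷ Y)))))

ones-after-nonfull-prefix : ∀ {r} P S → ZeroOneBalanced r → r ≡ P ++ S → count P < length P →
                            count S ≤ suc (count P)
ones-after-nonfull-prefix {r} P S bal eq nonfull
  with Q , Q₂ , refl ← ∈-∃++ (count<length⇒false∈ {P} nonfull) = begin
    count S                        ≤⟨ m≤n+m (count S) (count Q₂) ⟩
    count Q₂ + count S             ≡⟨ count-++ Q₂ S ⟨
    count (Q₂ ++ S)                ≤⟨ ones-after-zero bal Q (Q₂ ++ S) eq′ ⟩
    suc (count Q)                  ≤⟨ s≤s (m≤m+n (count Q) (count Q₂)) ⟩
    suc (count Q + count Q₂)       ≡⟨ cong suc (count-++ Q (false ∷ Q₂)) ⟨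
    suc (count (Q ++ false ∷ Q₂))  ∎
  where
  open ≤-Reasoning
  eq′ : r ≡ Q ++ false ∷ Q₂ ++ S
  eq′ = trans eq (++-assoc Q (false ∷ Q₂) S)

oneZeroBalanced⇒reverse : ∀ {r} → OneZeroBalanced r → ZeroOneBalanced (reverse r)
oneZeroBalanced⇒reverse {r} bal {pre} {post} eq =
  subst₂ _≤_ (count-reverse post) (count-reverse pre) (bal (begin
    r                                           ≡⟨ reverse-involutive r ⟨
    reverse (reverse r)                         ≡⟨ cong reverse eq ⟩
    reverse (pre ++ false ∷ true ∷ post)        ≡⟨ reverse-++-∷-∷ pre false true post ⟩
    reverse post ++ true ∷ false ∷ reverse pre  ∎))
  where open ≡-Reasoning

ones-before-nonfull-suffix : ∀ {r} P S → OneZeroBalanced r → r ≡ P ++ S → count S < length S →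
                             count P ≤ suc (count S)
ones-before-nonfull-suffix P S bal eq nonfull =
  subst₂ (λ a b → a ≤ suc b) (count-reverse P) (count-reverse S)
    (ones-after-nonfull-prefix (reverse S) (reverse P) (oneZeroBalanced⇒reverse bal)
      (trans (cong reverse eq) (reverse-++ P S))
      (subst₂ _<_ (sym (count-reverse S)) (sym (length-reverse S)) nonfull))

balanced⇒cut-product-maximal :
  ∀ {r} P S P' S' → ZeroOneBalanced r → OneZeroBalanced r → r ≡ P ++ S →
  length P' ≡ length P → length S' ≡ length S → count (P' ++ S') ≡ count r →
  count P' * count S' ≤ count P * count S
balanced⇒cut-product-maximal P S P' S' bal₀₁ bal₁₀ eq |P'|≡|P| |S'|≡|S| same-count =
  by-lighter-side (≤-total (count P) (count S))
  where
  sums : count P' + count S' ≡ count P + count S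
  sums = trans (sym (count-++ P' S')) (trans same-count (trans (cong count eq) (count-++ P S)))
  by-lighter-side : count P ≤ count S ⊎ count S ≤ count P → count P' * count S' ≤ count P * count S
  by-lighter-side (inj₁ c≤d) =
    cut-product-≤ c≤d (subst (count P' ≤_) |P'|≡|P| (count≤length P')) sums
      (ones-after-nonfull-prefix P S bal₀₁ eq)
  by-lighter-side (inj₂ d≤c) =
    subst₂ _≤_ (*-comm (count S') (count P')) (*-comm (count S) (count P))
      (cut-product-≤ d≤c (subst (count S' ≤_) |S'|≡|S| (count≤length S'))
        (trans (+-comm (count S') (count P')) (trans sums (+-comm (count P) (count S))))
        (ones-before-nonfull-suffix P S bal₁₀ eq))

balanced⇒cutSum-≤ : ∀ {r} → ZeroOneBalanced r → OneZeroBalanced r → ∀ P S P' S' → r ≡ P ++ S →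
                    length P' ≡ length P → length S' ≡ length S → count (P' ++ S') ≡ count r →
                    cutSum (count P') S' ≤ cutSum (count P) S
balanced⇒cutSum-≤ bal₀₁ bal₁₀ P []      P' []        _  _        _        _          = z≤n
balanced⇒cutSum-≤ {r} bal₀₁ bal₁₀ P (x ∷ T) P' (x' ∷ T') eq |P'|≡|P| |S'|≡|S| same-count = begin
  cutSum (count P') (x' ∷ T')
    ≡⟨ cutSum-∷ P' x' T' ⟩
  count (P' ++ [ x' ]) * count T' + cutSum (count (P' ++ [ x' ])) T'
    ≤⟨ +-mono-≤ (balanced⇒cut-product-maximal (P ++ [ x ]) T (P' ++ [ x' ]) T' bal₀₁ bal₁₀
                   eq′ |P'x'|≡|Px| |T'|≡|T| same-count′)
                (balanced⇒cutSum-≤ bal₀₁ bal₁₀ (P ++ [ x ]) T (P' ++ [ x' ]) T'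
                   eq′ |P'x'|≡|Px| |T'|≡|T| same-count′) ⟩
  count (P ++ [ x ]) * count T + cutSum (count (P ++ [ x ])) T
    ≡⟨ cutSum-∷ P x T ⟨
  cutSum (count P) (x ∷ T) ∎
  where
  open ≤-Reasoning
  eq′ : r ≡ (P ++ [ x ]) ++ T
  eq′ = trans eq (sym (++-assoc P [ x ] T))
  |P'x'|≡|Px| : length (P' ++ [ x' ]) ≡ length (P ++ [ x ])
  |P'x'|≡|Px| = trans (length-++ P') (trans (cong (_+ 1) |P'|≡|P|) (sym (length-++ P)))
  |T'|≡|T| : length T' ≡ length T
  |T'|≡|T| = suc-injective |S'|≡|S|
  same-count′ : count ((P' ++ [ x' ]) ++ T') ≡ count r
  same-count′ = trans (cong count (++-assoc P' [ x' ] T')) same-count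

balanced⇒cutSum-maximal : ∀ {r} b → ZeroOneBalanced r → OneZeroBalanced r →
                          length b ≡ length r → count b ≡ count r → cutSum 0 b ≤ cutSum 0 r
balanced⇒cutSum-maximal {r} b bal₀₁ bal₁₀ = balanced⇒cutSum-≤ bal₀₁ bal₁₀ [] r [] b refl refl

-- W as a cut sum

-- The sum of the (0-based) positions of the ones.
indexSum : List Bool → ℕ
indexSum []      = 0
indexSum (_ ∷ l) = count l + indexSum l

sum-map-cong : ∀ {A : Set} {f g : A → ℕ} → (∀ x → f x ≡ g x) →
               ∀ xs → sum (map f xs) ≡ sum (map g xs)
sum-map-cong f≗g xs = cong sum (map-cong f≗g xs)

sum-map-zero : ∀ {A : Set} (xs : List A) → sum (map (λ _ → 0) xs) ≡ 0
sum-map-zero []       = refl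
sum-map-zero (_ ∷ xs) = sum-map-zero xs

sum-allFin-suc : ∀ {n} (f : Fin (suc n) → ℕ) →
                 sum (map f (allFin (suc n))) ≡ f zero + sum (map (f ∘ suc) (allFin n))
sum-allFin-suc f =
  cong (λ xs → f zero + sum xs) (trans (map-tabulate suc f) (sym (map-tabulate id (f ∘ suc))))

sum-shifted-indices : ∀ {n} k (X : Subset n) →
  sum (map (λ v → if lookup X v then k + toℕ v else 0) (allFin n))
    ≡ k * count (toList X) + indexSum (toList X)
sum-shifted-indices k []      = sym (trans (+-identityʳ (k * 0)) (*-zeroʳ k))
sum-shifted-indices k (b ∷ X) = begin
  sum (map (λ v → if lookup (b ∷ X) v then k + toℕ v else 0) (allFin _))
    ≡⟨ sum-allFin-suc (λ v → if lookup (b ∷ X) v then k + toℕ v else 0) ⟩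
  (if b then k + 0 else 0) + sum (map (λ v → if lookup X v then k + suc (toℕ v) else 0) (allFin _))
    ≡⟨ cong ((if b then k + 0 else 0) +_)
         (trans (sum-map-cong (λ v → cong (if lookup X v then_else 0) (+-suc k (toℕ v))) (allFin _))
                (sum-shifted-indices (suc k) X)) ⟩
  (if b then k + 0 else 0) + (suc k * count l + indexSum l)
    ≡⟨ rearrange b ⟩
  k * count (b ∷ l) + (count l + indexSum l) ∎
  where
  open ≡-Reasoning
  l : List Bool
  l = toList X
  rearrange : ∀ b → (if b then k + 0 else 0) + (suc k * count l + indexSum l)
                    ≡ k * count (b ∷ l) + (count l + indexSum l)
  rearrange true  = ring k (count l) (indexSum l)
    where
    ring : ∀ k c t → k + 0 + (suc k * c + t) ≡ k * suc c + (c + t)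
    ring = solve-∀
  rearrange false = ring k (count l) (indexSum l)
    where
    ring : ∀ k c t → suc k * c + t ≡ k * c + (c + t)
    ring = solve-∀

W-∷ : ∀ {n} b (X : Subset n) →
      W (b ∷ X) ≡ (if b then count (toList X) + indexSum (toList X) else 0) + W X
W-∷ {n} b X = begin
  W (b ∷ X)
    ≡⟨ sum-allFin-suc (row (b ∷ X)) ⟩
  row (b ∷ X) zero + sum (map (row (b ∷ X) ∘ suc) (allFin n))
    ≡⟨ cong₂ _+_ (first-row b) (sum-map-cong other-row (allFin n)) ⟩
  (if b then count (toList X) + indexSum (toList X) else 0) + W X ∎
  where
  open ≡-Reasoning
  pair : ∀ {m} → Subset m → Fin m → Fin m → ℕ
  pair Y u v = if lookup Y u ∧ lookup Y v ∧ (toℕ u <ᵇ toℕ v) then dist u v else 0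
  row : ∀ {m} → Subset m → Fin m → ℕ
  row Y u = sum (map (pair Y u) (allFin _))
  first-row : ∀ b → row (b ∷ X) zero ≡ (if b then count (toList X) + indexSum (toList X) else 0)
  first-row true = begin
    row (true ∷ X) zero
      ≡⟨ sum-allFin-suc (pair (true ∷ X) zero) ⟩
    sum (map (λ v → if lookup X v ∧ true then suc (toℕ v) else 0) (allFin n))
      ≡⟨ sum-map-cong (λ v → cong (if_then suc (toℕ v) else 0) (∧-identityʳ (lookup X v)))
                      (allFin n) ⟩
    sum (map (λ v → if lookup X v then 1 + toℕ v else 0) (allFin n))
      ≡⟨ sum-shifted-indices 1 X ⟩
    1 * count (toList X) + indexSum (toList X)
      ≡⟨ cong (_+ indexSum (toList X)) (*-identityˡ (count (toList X))) ⟩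
    count (toList X) + indexSum (toList X) ∎
  first-row false = trans (sum-allFin-suc (pair (false ∷ X) zero)) (sum-map-zero (allFin n))
  other-row : ∀ u → row (b ∷ X) (suc u) ≡ row X u
  other-row u = trans (sum-allFin-suc (pair (b ∷ X) (suc u)))
    (cong (λ c → (if c then dist (suc u) zero else 0) + row X u)
          (trans (cong (lookup X u ∧_) (∧-zeroʳ b)) (∧-zeroʳ (lookup X u))))

cutSum-toList : ∀ {n} a (X : Subset n) → cutSum a (toList X) ≡ W X + a * indexSum (toList X)
cutSum-toList a []          = sym (*-zeroʳ a)
cutSum-toList a (true ∷ X)  = begin
  suc a * c + cutSum (suc a) (toList X)  ≡⟨ cong (suc a * c +_) (cutSum-toList (suc a) X) ⟩
  suc a * c + (W X + suc a * t)          ≡⟨ ring a c (W X) t ⟩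
  (c + t) + W X + a * (c + t)            ≡⟨ cong (_+ a * (c + t)) (W-∷ true X) ⟨
  W (true ∷ X) + a * (c + t)             ∎
  where
  open ≡-Reasoning
  c t : ℕ
  c = count (toList X)
  t = indexSum (toList X)
  ring : ∀ a c w t → suc a * c + (w + suc a * t) ≡ (c + t) + w + a * (c + t)
  ring = solve-∀
cutSum-toList a (false ∷ X) = begin
  a * c + cutSum a (toList X)            ≡⟨ cong (a * c +_) (cutSum-toList a X) ⟩
  a * c + (W X + a * t)                  ≡⟨ ring a c (W X) t ⟩
  0 + W X + a * (c + t)                  ≡⟨ cong (_+ a * (c + t)) (W-∷ false X) ⟨
  W (false ∷ X) + a * (c + t)            ∎
  where
  open ≡-Reasoning
  c t : ℕ
  c = count (toList X)
  t = indexSum (toList X)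
  ring : ∀ a c w t → a * c + (w + a * t) ≡ 0 + w + a * (c + t)
  ring = solve-∀

W≡cutSum : ∀ {n} (X : Subset n) → W X ≡ cutSum 0 (toList X)
W≡cutSum X = sym (trans (cutSum-toList 0 X) (+-identityʳ (W X)))

∣p∣≡count : ∀ {n} (p : Subset n) → ∣ p ∣ ≡ count (toList p)
∣p∣≡count []          = refl
∣p∣≡count (true ∷ p)  = cong suc (∣p∣≡count p)
∣p∣≡count (false ∷ p) = ∣p∣≡count p

x∈p⇒1+∣p-x∣≡∣p∣ : ∀ {n} {x : Fin n} {p : Subset n} → x ∈ p → suc ∣ p - x ∣ ≡ ∣ p ∣
x∈p⇒1+∣p-x∣≡∣p∣ {p = true ∷ p}  here        = cong (suc ∘ ∣_∣) (p─⊥≡p p)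
x∈p⇒1+∣p-x∣≡∣p∣ {p = true ∷ p}  (there x∈p) = cong suc (x∈p⇒1+∣p-x∣≡∣p∣ x∈p)
x∈p⇒1+∣p-x∣≡∣p∣ {p = false ∷ p} (there x∈p) = x∈p⇒1+∣p-x∣≡∣p∣ x∈p

x∉p⇒∣p∪⁅x⁆∣≡1+∣p∣ : ∀ {n} {x : Fin n} {p : Subset n} → x ∉ p → ∣ p ∪ ⁅ x ⁆ ∣ ≡ suc ∣ p ∣
x∉p⇒∣p∪⁅x⁆∣≡1+∣p∣ {x = zero}  {true ∷ p}  x∉p = contradiction here x∉p
x∉p⇒∣p∪⁅x⁆∣≡1+∣p∣ {x = zero}  {false ∷ p} _   = cong (suc ∘ ∣_∣) (∪-identityʳ p)
x∉p⇒∣p∪⁅x⁆∣≡1+∣p∣ {x = suc x} {true ∷ p}  x∉p = cong suc (x∉p⇒∣p∪⁅x⁆∣≡1+∣p∣ (x∉p ∘ there))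
x∉p⇒∣p∪⁅x⁆∣≡1+∣p∣ {x = suc x} {false ∷ p} x∉p = x∉p⇒∣p∪⁅x⁆∣≡1+∣p∣ (x∉p ∘ there)

perturbation-card : ∀ {n} {X Y : Subset n} → IsPerturbation X Y → ∣ Y ∣ ≡ ∣ X ∣
perturbation-card {X = X} (u , v , u∈X , v∉X , _ , refl) =
  trans (x∉p⇒∣p∪⁅x⁆∣≡1+∣p∣ (v∉X ∘ p─q⊆p X ⁅ u ⁆)) (x∈p⇒1+∣p-x∣≡∣p∣ u∈X)

swap-isPerturbation : ∀ {n} (R : Subset n) pre {x y} post →
                      toList R ≡ pre ++ x ∷ y ∷ post → x ≢ y →
                      Σ[ Y ∈ Subset n ] IsPerturbation R Y × toList Y ≡ pre ++ y ∷ x ∷ post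
swap-isPerturbation (true ∷ true ∷ R)   [] _ refl x≢y = contradiction refl x≢y
swap-isPerturbation (false ∷ false ∷ R) [] _ refl x≢y = contradiction refl x≢y
swap-isPerturbation (true ∷ false ∷ R)  [] _ refl _   =
  _ , (zero , suc zero , here , (λ { (there ()) }) , inj₁ refl , refl) ,
  cong (λ Z → false ∷ true ∷ toList Z) (trans (∪-identityʳ _) (p─⊥≡p R))
swap-isPerturbation (false ∷ true ∷ R)  [] _ refl _   =
  _ , (suc zero , zero , there here , (λ ()) , inj₂ refl , refl) ,
  cong (λ Z → true ∷ false ∷ toList Z) (trans (∪-identityʳ _) (p─⊥≡p R))
swap-isPerturbation (r ∷ R) (_ ∷ pre) post eq x≢y with ∷-injective eq
... | refl , eq′ with swap-isPerturbation R pre post eq′ x≢y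
... | _ , (u , v , u∈R , v∉R , edge , refl) , toList-Y =
  _ , (suc u , suc v , there u∈R , v∉R ∘ drop-there , ⊎-map (cong suc) (cong suc) edge , refl) ,
  cong₂ _∷_ (∨-identityʳ r) toList-Y

LocalMax : ∀ {n} → Subset n → Set
LocalMax R = ∀ Y → IsPerturbation R Y → W Y ≤ W R

localMax⇒swapOptimal : ∀ {n} {R : Subset n} → LocalMax R → SwapOptimal (toList R)
localMax⇒swapOptimal {R = R} max {pre} {x} {y} {post} eq x≢y
  with Y , perturbation , toList-Y ← swap-isPerturbation R pre post eq x≢y = begin
    cutSum 0 (pre ++ y ∷ x ∷ post)  ≡⟨ cong (cutSum 0) toList-Y ⟨
    cutSum 0 (toList Y)             ≡⟨ W≡cutSum Y ⟨
    W Y                             ≤⟨ max Y perturbation ⟩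
    W R                             ≡⟨ W≡cutSum R ⟩
    cutSum 0 (toList R)             ∎
  where open ≤-Reasoning

localMax⇒globalMax : ∀ {n} {R B : Subset n} → LocalMax R → ∣ B ∣ ≡ ∣ R ∣ → W B ≤ W R
localMax⇒globalMax {R = R} {B} max ∣B∣≡∣R∣ = begin
  W B                  ≡⟨ W≡cutSum B ⟩
  cutSum 0 (toList B)  ≤⟨ balanced⇒cutSum-maximal (toList B)
                            (swapOptimal⇒zeroOneBalanced opt) (swapOptimal⇒oneZeroBalanced opt)
                            (trans (length-toList B) (sym (length-toList R)))
                            (trans (sym (∣p∣≡count B)) (trans ∣B∣≡∣R∣ (∣p∣≡count R))) ⟩
  cutSum 0 (toList R)  ≡⟨ W≡cutSum R ⟨
  W R                  ∎
  where
  open ≤-Reasoning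
  opt : SwapOptimal (toList R)
  opt = localMax⇒swapOptimal max

module _ {n} (L : Subset n → List (Subset n)) (F : Subset n → ℕ) where

  als-no-improvement : ∀ {A R} → ALS L F A R → All (λ Y → F Y ≤ F R) (L R)
  als-no-improvement (stop no-improvement)   = no-improvement
  als-no-improvement (step _ _ _ _ _ _ rest) = als-no-improvement rest

  als-preserves : ∀ {B : Set} (g : Subset n → B) → (∀ {X Y} → Y ∈ₗ L X → g Y ≡ g X) →
                  ∀ {A R} → ALS L F A R → g R ≡ g A
  als-preserves g invariant (stop _)                   = refl
  als-preserves g invariant (step pre _ _ L≡ _ _ rest) =
    trans (als-preserves g invariant rest)
          (invariant (subst (_ ∈ₗ_) (sym L≡) (∈-++⁺ʳ pre (Any.here refl))))

  als-terminates : ∀ U → (∀ X → F X ≤ U) → ∀ A → Σ (Subset n) (ALS L F A)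
  als-terminates U bounded A = run U A (m≤m+n U (F A))
    where
    run : ∀ k X → U ≤ k + F X → Σ (Subset n) (ALS L F X)
    climb : ∀ k X {xs} → U ≤ k + F X →
            First.FirstView (λ Y → F Y ≤ F X) (λ Y → F X < F Y) xs → L X ≡ xs →
            Σ (Subset n) (ALS L F X)
    run k X U≤ with First.first (λ Y → ≤-<-connex (F Y) (F X)) (L X)
    ... | inj₂ no-improvement = X , stop no-improvement
    ... | inj₁ improvement    = climb k X U≤ (toView improvement) refl
    climb zero    X U≤ (First._++_∷_ {y = Y} _ better _) _ =
      contradiction (<-≤-trans better (≤-trans (bounded Y) U≤)) (<-irrefl refl)
    climb (suc k) X U≤ (First._++_∷_ {y = Y} not-better better post) L≡ =
      let R , rest = run k Y (≤-trans U≤ (≤-trans (≤-reflexive (sym (+-suc k (F X))))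
                                                  (+-monoʳ-≤ k better)))
      in R , step _ post Y L≡ not-better better rest

sum-map-mono : ∀ {A : Set} {f g : A → ℕ} → (∀ x → f x ≤ g x) →
               ∀ xs → sum (map f xs) ≤ sum (map g xs)
sum-map-mono f≤g []       = z≤n
sum-map-mono f≤g (x ∷ xs) = +-mono-≤ (f≤g x) (sum-map-mono f≤g xs)

if-then-0-≤ : ∀ b m → (if b then m else 0) ≤ m
if-then-0-≤ true  m = ≤-refl
if-then-0-≤ false m = z≤n

totalDistance : ℕ → ℕ
totalDistance n = sum (map (λ u → sum (map (dist u) (allFin n))) (allFin n))

W≤totalDistance : ∀ {n} (X : Subset n) → W X ≤ totalDistance n
W≤totalDistance {n} X =
  sum-map-mono (λ u → sum-map-mono (λ v → if-then-0-≤ _ (dist u v)) (allFin n)) (allFin n)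

corollary4p3 : (n : ℕ) (L : Subset n → List (Subset n)) → ListsPerturbations L →
    (A : Subset n) → 2 ≤ ∣ A ∣ →
      Σ (Subset n) (λ R → ALS L W A R)
      × (∀ R → ALS L W A R →
           (∣ R ∣ ≡ ∣ A ∣) × (∀ (B : Subset n) → ∣ B ∣ ≡ ∣ A ∣ → W B ≤ W R))
corollary4p3 n L perturbations A _ =
    als-terminates L W (totalDistance n) W≤totalDistance A
  , λ R run → same-size run
            , λ B ∣B∣≡∣A∣ → localMax⇒globalMax {B = B} (local-max run)
                                                (trans ∣B∣≡∣A∣ (sym (same-size run)))
  where
  same-size : ∀ {R} → ALS L W A R → ∣ R ∣ ≡ ∣ A ∣
  same-size = als-preserves L W ∣_∣ (λ {X} {Y} → perturbation-card ∘ proj₁ (perturbations X Y))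
  local-max : ∀ {R} → ALS L W A R → LocalMax R
  local-max {R} run Y = All.lookup (als-no-improvement L W run) ∘ proj₂ (perturbations R Y)
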